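{- Let $X$ be a $(95,40,12,20)$ strongly regular graph and let $K$ be a $4$-clique of $X$ that is not contained in any $5$-clique of $X$. For $i\in\{0,1,2,3\}$ let $X_i$ be the set of vertices of $V(X)\setminus V(K)$ having exactly $i$ neighbours in $K$, and suppose $(|X_0|,|X_1|,|X_2|,|X_3|)=(0,37,51,3)$. Write $X_3=\{x_0,x_1,x_2\}$ and for $i\in\{0,1,2\}$ let $X_2^i$ be the set of neighbours of $x_i$ in $X_2$. Then for each $i\in\{1,2\}$ the subgraph of $X$ induced on $X_2^0\setminus X_2^i$ is triangle-free.
   Context: A $k$-regular graph $G$ on $v$ vertices is a $(v,k,\lambda,\mu)$ strongly regular graph if any two distinct adjacent vertices have exactly $\lambda$ common neighbours and any two distinct non-adjacent vertices have exactly $\mu$ common neighbours. -}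

module Defs where

open import Data.Nat using (ℕ; _≡ᵇ_)
open import Data.Bool using (Bool; true; false; _∧_; not)
open import Data.Fin using (Fin)
open import Data.List using (length; filterᵇ; allFin)
open import Data.Product using (Σ; _×_; ∃)
open import Relation.Binary.PropositionalEquality using (_≡_; _≢_)
open import Relation.Nullary using (¬_)

record Graph (n : ℕ) : Set where
  field
    adj   : Fin n → Fin n → Bool
    sym   : ∀ x y → adj x y ≡ adj y x
    irrefl : ∀ x → adj x x ≡ false
open Graph public

Subset : ℕ → Set
Subset n = Fin n → Bool

count : {n : ℕ} → Subset n → ℕ
count {n} P = length (filterᵇ P (allFin n))

degree : {n : ℕ} → Graph n → Fin n → ℕ
degree G x = count (adj G x)

commonNeighbours : {n : ℕ} → Graph n → Fin n → Fin n → ℕ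
commonNeighbours G x y = count (λ z → adj G x z ∧ adj G y z)

IsSRG : (v k l m : ℕ) → Graph v → Set
IsSRG v k l m G =
  (∀ x → degree G x ≡ k) ×
  (∀ x y → x ≢ y → adj G x y ≡ true → commonNeighbours G x y ≡ l) ×
  (∀ x y → x ≢ y → adj G x y ≡ false → commonNeighbours G x y ≡ m)

_⊆_ : {n : ℕ} → Subset n → Subset n → Set
A ⊆ B = ∀ z → A z ≡ true → B z ≡ true

IsClique : {n : ℕ} → Graph n → Subset n → Set
IsClique G C = ∀ x y → C x ≡ true → C y ≡ true → x ≢ y → adj G x y ≡ true

IsSClique : {n : ℕ} → ℕ → Graph n → Subset n → Set
IsSClique s G C = IsClique G C × count C ≡ s

nbrsIn : {n : ℕ} → Graph n → Subset n → Fin n → ℕ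
nbrsIn G K z = count (λ w → K w ∧ adj G z w)

Layer : {n : ℕ} → Graph n → Subset n → ℕ → Subset n
Layer G K i z = not (K z) ∧ (nbrsIn G K z ≡ᵇ i)

TriangleFree : {n : ℕ} → Graph n → Subset n → Set
TriangleFree G S = ∀ a b c → S a ≡ true → S b ≡ true → S c ≡ true →
  adj G a b ≡ true → adj G b c ≡ true → adj G a c ≡ true → Data.Empty.⊥
  where import Data.Empty

-- If a, b, d formed a triangle in X₂ ∩ N(x) for some x ∈ X₃, then
-- S = K ∪ {x, a, b, d} would be an 8-set spanning 6 + 3 + 3·2 + 3 + 3 = 21 edges.
-- The adjacency matrix A of a (95,40,12,20) graph satisfies A² + 8A = 20J + 20I,
-- so its eigenvalues are 40 (on the all-ones vector), 2 and −10.  Hence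
-- A ≤ 2I + (2/5)J as quadratic forms, and any vertex set S spans at most
-- |S| + |S|²/5 edges: 20.8 < 21 when |S| = 8.
module Submission where

open import Defs
open import Data.Bool using (Bool; true; false; _∧_; not; T)
open import Data.Fin using (Fin; zero; suc)
open import Data.Fin.Properties using (_≟_)
open import Data.List using (length; filterᵇ; tabulate)
open import Data.Nat using (ℕ; zero; suc; _+_; _*_; _≤_; _≡ᵇ_; z≤n)
open import Data.Nat.Properties
  using ( +-*-semiring; +-identityʳ; *-identityˡ; *-identityʳ; *-comm
        ; *-distribˡ-+; *-distribʳ-+; +-mono-≤; +-monoˡ-≤; m≤m+n; ≤-total
        ; m≤n⇒∃[o]m+o≡n; +-cancelʳ-≤; *-cancelˡ-≤; suc-injective; ≡ᵇ⇒≡; ≤⇒≤ᵇ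
        ; module ≤-Reasoning)
open import Data.Nat.Tactic.RingSolver using (solve-∀)
open import Data.Product using (_×_; ∃-syntax; _,_; proj₁; proj₂)
open import Data.Sum using (inj₁; inj₂)
open import Data.Unit using (tt)
open import Function using (_∘_)
open import Function.Definitions using (Injective)
open import Relation.Binary.PropositionalEquality as ≡
  using (_≡_; _≢_; refl; trans; cong; cong₂; subst; subst₂; module ≡-Reasoning)
open import Relation.Nullary using (¬_; does; yes; no)
open import Relation.Nullary.Decidable using (dec-true; dec-false)
open import Algebra.Properties.Semiring.Sum +-*-semiring
  using (sum; sum-syntax; sum-cong-≗; sum-replicate-zero; ∑-distrib-+; ∑-comm; *-distribˡ-sum; *-distribʳ-sum)

𝟙 : Bool → ℕ
𝟙 true  = 1
𝟙 false = 0

𝟙-∧ : ∀ a b → 𝟙 (a ∧ b) ≡ 𝟙 a * 𝟙 b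
𝟙-∧ true  b = ≡.sym (+-identityʳ (𝟙 b))
𝟙-∧ false b = refl

𝟙-idem : ∀ a → 𝟙 a * 𝟙 a ≡ 𝟙 a
𝟙-idem true  = refl
𝟙-idem false = refl

δ : ∀ {n} → Fin n → Fin n → ℕ
δ u w = 𝟙 (does (u ≟ w))

δ-refl : ∀ {n} (u : Fin n) → δ u u ≡ 1
δ-refl u = cong 𝟙 (dec-true (u ≟ u) refl)

δ-≢ : ∀ {n} {u w : Fin n} → u ≢ w → δ u w ≡ 0
δ-≢ {u = u} {w} u≢w = cong 𝟙 (dec-false (u ≟ w) u≢w)

∧-true : ∀ {a b} → a ∧ b ≡ true → a ≡ true × b ≡ true
∧-true {true} b = refl , b

length-filterᵇ-tabulate : ∀ {a} {A : Set a} {n} (P : A → Bool) (f : Fin n → A) →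
  length (filterᵇ P (tabulate f)) ≡ ∑[ i < n ] 𝟙 (P (f i))
length-filterᵇ-tabulate {n = zero}  P f = refl
length-filterᵇ-tabulate {n = suc n} P f with P (f zero)
... | true  = cong suc (length-filterᵇ-tabulate P (f ∘ suc))
... | false = length-filterᵇ-tabulate P (f ∘ suc)

count≡∑𝟙 : ∀ {n} (P : Subset n) → count P ≡ ∑[ z < n ] 𝟙 (P z)
count≡∑𝟙 P = length-filterᵇ-tabulate P (λ z → z)

∑-const : ∀ n k → ∑[ i < n ] k ≡ n * k
∑-const zero    k = refl
∑-const (suc n) k = cong (k +_) (∑-const n k)

∑-*ˡ : ∀ {n} k (f : Fin n → ℕ) → ∑[ i < n ] (k * f i) ≡ k * sum f
∑-*ˡ k f = ≡.sym (*-distribˡ-sum k f)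

∑*∑ : ∀ {n} (f g : Fin n → ℕ) → sum f * sum g ≡ ∑[ u < n ] ∑[ w < n ] (f u * g w)
∑*∑ f g = trans (*-distribʳ-sum (sum g) f) (sum-cong-≗ (λ u → *-distribˡ-sum (f u) g))

∑-δ : ∀ {n} (u : Fin n) (f : Fin n → ℕ) → ∑[ w < n ] (δ u w * f w) ≡ f u
∑-δ {suc n} zero    f =
  trans (cong₂ _+_ (*-identityˡ (f zero)) (sum-replicate-zero n)) (+-identityʳ (f zero))
∑-δ {suc n} (suc u) f = ∑-δ u (f ∘ suc)

∑-mono-≤ : ∀ {n} {f g : Fin n → ℕ} → (∀ i → f i ≤ g i) → sum f ≤ sum g
∑-mono-≤ {zero}  f≤g = z≤n
∑-mono-≤ {suc n} f≤g = +-mono-≤ (f≤g zero) (∑-mono-≤ (f≤g ∘ suc))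

∑-+-*ˡ : ∀ {n} k m (f g : Fin n → ℕ) → ∑[ z < n ] (k * f z + m * g z) ≡ k * sum f + m * sum g
∑-+-*ˡ k m f g =
  trans (∑-distrib-+ (λ z → k * f z) (λ z → m * g z)) (cong₂ _+_ (∑-*ˡ k f) (∑-*ˡ m g))

2mn≤m²+n² : ∀ m n → 2 * (m * n) ≤ m * m + n * n
2mn≤m²+n² m n with ≤-total m n
... | inj₁ m≤n with m≤n⇒∃[o]m+o≡n m≤n
...   | t , refl = subst (2 * (m * (m + t)) ≤_) (square m t) (m≤m+n _ (t * t))
  where square : ∀ m t → 2 * (m * (m + t)) + t * t ≡ m * m + (m + t) * (m + t)
        square = solve-∀
2mn≤m²+n² m n | inj₂ n≤m with m≤n⇒∃[o]m+o≡n n≤m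
...   | t , refl = subst (2 * ((n + t) * n) ≤_) (square n t) (m≤m+n _ (t * t))
  where square : ∀ n t → 2 * ((n + t) * n) + t * t ≡ (n + t) * (n + t) + n * n
        square = solve-∀

+-cong₅ : ∀ {a b c d e a′ b′ c′ d′ e′ : ℕ} → a ≡ a′ → b ≡ b′ → c ≡ c′ → d ≡ d′ → e ≡ e′ →
          a + b + c + d + e ≡ a′ + b′ + c′ + d′ + e′
+-cong₅ refl refl refl refl refl = refl

module _ {n : ℕ} where

  infix 8 _·_

  _·_ : (f g : Fin n → ℕ) → ℕ
  f · g = ∑[ z < n ] (f z * g z)

  ·-comm : ∀ f g → f · g ≡ g · f
  ·-comm f g = sum-cong-≗ (λ z → *-comm (f z) (g z))

  ·-distribʳ-+ : ∀ f f′ g → (λ z → f z + f′ z) · g ≡ f · g + f′ · g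
  ·-distribʳ-+ f f′ g =
    trans (sum-cong-≗ (λ z → *-distribʳ-+ (g z) (f z) (f′ z))) (∑-distrib-+ (λ z → f z * g z) (λ z → f′ z * g z))

  form : (Fin n → Fin n → ℕ) → (Fin n → ℕ) → ℕ
  form M c = ∑[ u < n ] ∑[ w < n ] (c u * c w * M u w)

  form-cong : ∀ {M M′} c → (∀ u w → M u w ≡ M′ u w) → form M c ≡ form M′ c
  form-cong c M≡M′ = sum-cong-≗ (λ u → sum-cong-≗ (λ w → cong (c u * c w *_) (M≡M′ u w)))

  form-+ : ∀ M M′ c → form (λ u w → M u w + M′ u w) c ≡ form M c + form M′ c
  form-+ M M′ c =
    trans (sum-cong-≗ (λ u →
            trans (sum-cong-≗ (λ w → *-distribˡ-+ (c u * c w) (M u w) (M′ u w)))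
                                  (∑-distrib-+ (λ w → c u * c w * M u w) (λ w → c u * c w * M′ u w))))
          (∑-distrib-+ (λ u → ∑[ w < n ] (c u * c w * M u w)) (λ u → ∑[ w < n ] (c u * c w * M′ u w)))

  form-* : ∀ k M c → form (λ u w → k * M u w) c ≡ k * form M c
  form-* k M c =
    trans (sum-cong-≗ (λ u →
            trans (sum-cong-≗ (λ w → swap (c u * c w) k (M u w))) (∑-*ˡ k (λ w → c u * c w * M u w))))
          (∑-*ˡ k (λ u → ∑[ w < n ] (c u * c w * M u w)))
    where swap : ∀ a k m → a * (k * m) ≡ k * (a * m)
          swap = solve-∀

  form-J : ∀ c → form (λ _ _ → 1) c ≡ sum c * sum c
  form-J c = trans (sum-cong-≗ (λ u → sum-cong-≗ (λ w → *-identityʳ (c u * c w)))) (≡.sym (∑*∑ c c))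

  form-I : ∀ c → form δ c ≡ c · c
  form-I c = sum-cong-≗ λ u →
    trans (sum-cong-≗ (λ w → *-comm (c u * c w) (δ u w))) (∑-δ u (λ w → c u * c w))

module _ {n : ℕ} (G : Graph n) where

  A : Fin n → Fin n → ℕ
  A u w = 𝟙 (adj G u w)

  A-sym : ∀ u w → A u w ≡ A w u
  A-sym u w = cong 𝟙 (Graph.sym G u w)

  nbrSum : (Fin n → ℕ) → Fin n → ℕ
  nbrSum c z = A z · c

  nbrsIn≡𝟙·A : ∀ K z → nbrsIn G K z ≡ 𝟙 ∘ K · A z
  nbrsIn≡𝟙·A K z = trans (count≡∑𝟙 (λ w → K w ∧ adj G z w)) (sum-cong-≗ (λ w → 𝟙-∧ (K w) (adj G z w)))

  commonNeighbours≡A·A : ∀ u w → commonNeighbours G u w ≡ A u · A w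
  commonNeighbours≡A·A u w = trans (count≡∑𝟙 (λ z → adj G u z ∧ adj G w z)) (sum-cong-≗ (λ z → 𝟙-∧ (adj G u z) (adj G w z)))

  ·nbrSum-sym : ∀ f g → f · nbrSum g ≡ g · nbrSum f
  ·nbrSum-sym f g = begin
    ∑[ z < n ] (f z * ∑[ u < n ] (A z u * g u))  ≡⟨ sum-cong-≗ (λ z → *-distribˡ-sum (f z) (λ u → A z u * g u)) ⟩
    ∑[ z < n ] ∑[ u < n ] (f z * (A z u * g u))  ≡⟨ ∑-comm (λ z u → f z * (A z u * g u)) ⟩
    ∑[ u < n ] ∑[ z < n ] (f z * (A z u * g u))  ≡⟨ sum-cong-≗ (λ u → sum-cong-≗ (λ z → swap u z)) ⟩
    ∑[ u < n ] ∑[ z < n ] (g u * (A u z * f z))  ≡⟨ sum-cong-≗ (λ u → ∑-*ˡ (g u) (λ z → A u z * f z)) ⟩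
    ∑[ u < n ] (g u * ∑[ z < n ] (A u z * f z))  ∎
    where
    open ≡-Reasoning
    rearrange : ∀ f a g → f * (a * g) ≡ g * (a * f)
    rearrange = solve-∀
    swap : ∀ u z → f z * (A z u * g u) ≡ g u * (A u z * f z)
    swap u z = trans (cong (λ a → f z * (a * g u)) (A-sym z u)) (rearrange (f z) (A u z) (g u))

  ·nbrSum≡form : ∀ c → c · nbrSum c ≡ form A c
  ·nbrSum≡form c = sum-cong-≗ λ u →
    trans (*-distribˡ-sum (c u) (λ w → A u w * c w)) (sum-cong-≗ (λ w → rearrange (c u) (A u w) (c w)))
    where rearrange : ∀ a m b → a * (m * b) ≡ a * b * m
          rearrange = solve-∀

  nbrSum·nbrSum≡form : ∀ c → nbrSum c · nbrSum c ≡ form (λ u w → commonNeighbours G u w) c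
  nbrSum·nbrSum≡form c = begin
    ∑[ z < n ] (A z · c * A z · c)                          ≡⟨ sum-cong-≗ (λ z → square z) ⟩
    ∑[ z < n ] ∑[ u < n ] ∑[ w < n ] (c u * c w * (A u z * A w z))
                                                           ≡⟨ ∑-comm (λ z u → ∑[ w < n ] (c u * c w * (A u z * A w z))) ⟩
    ∑[ u < n ] ∑[ z < n ] ∑[ w < n ] (c u * c w * (A u z * A w z))
                                                           ≡⟨ sum-cong-≗ (λ u → ∑-comm (λ z w → c u * c w * (A u z * A w z))) ⟩
    ∑[ u < n ] ∑[ w < n ] ∑[ z < n ] (c u * c w * (A u z * A w z))
                                                           ≡⟨ sum-cong-≗ (λ u → sum-cong-≗ (λ w → ∑-*ˡ (c u * c w) (λ z → A u z * A w z))) ⟩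
    form (λ u w → A u · A w) c                             ≡⟨ form-cong c (λ u w → ≡.sym (commonNeighbours≡A·A u w)) ⟩
    form (λ u w → commonNeighbours G u w) c                ∎
    where
    open ≡-Reasoning
    rearrange : ∀ a p b q → a * p * (b * q) ≡ p * q * (a * b)
    rearrange = solve-∀
    term : ∀ z u w → A z u * c u * (A z w * c w) ≡ c u * c w * (A u z * A w z)
    term z u w = trans (cong₂ (λ p q → p * c u * (q * c w)) (A-sym z u) (A-sym z w))
                       (rearrange (A u z) (c u) (A w z) (c w))
    square : ∀ z → A z · c * A z · c ≡ ∑[ u < n ] ∑[ w < n ] (c u * c w * (A u z * A w z))
    square z = trans (∑*∑ (λ u → A z u * c u) (λ w → A z w * c w)) (sum-cong-≗ (λ u → sum-cong-≗ (λ w → term z u w)))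

  ∑nbrSum : ∀ {k} → (∀ x → degree G x ≡ k) → ∀ c → sum (nbrSum c) ≡ k * sum c
  ∑nbrSum {k} regular c = begin
    ∑[ z < n ] ∑[ u < n ] (A z u * c u)  ≡⟨ ∑-comm (λ z u → A z u * c u) ⟩
    ∑[ u < n ] ∑[ z < n ] (A z u * c u)  ≡⟨ sum-cong-≗ (λ u → sum-cong-≗ (λ z → cong (_* c u) (A-sym z u))) ⟩
    ∑[ u < n ] ∑[ z < n ] (A u z * c u)  ≡⟨ sum-cong-≗ (λ u → ≡.sym (*-distribʳ-sum (c u) (A u))) ⟩
    ∑[ u < n ] (sum (A u) * c u)         ≡⟨ sum-cong-≗ (λ u → cong (_* c u) (degree≡ u)) ⟩
    ∑[ u < n ] (k * c u)                 ≡⟨ ∑-*ˡ k c ⟩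
    k * sum c                            ∎
    where
    open ≡-Reasoning
    degree≡ : ∀ u → sum (A u) ≡ k
    degree≡ u = trans (≡.sym (count≡∑𝟙 (adj G u))) (regular u)

  adj⇒≢ : ∀ {u w} → adj G u w ≡ true → u ≢ w
  adj⇒≢ {u} uw refl with () ← trans (≡.sym uw) (irrefl G u)

  nbrSum𝟙≡nbrsIn : ∀ K z → nbrSum (𝟙 ∘ K) z ≡ nbrsIn G K z
  nbrSum𝟙≡nbrsIn K z = trans (·-comm (A z) (𝟙 ∘ K)) (≡.sym (nbrsIn≡𝟙·A K z))

  nbrsIn-clique : ∀ {K} → IsClique G K → ∀ {z} → K z ≡ true → 1 + nbrsIn G K z ≡ count K
  nbrsIn-clique {K} K-clique {z} Kz = begin
    1 + nbrsIn G K z                                   ≡⟨ cong₂ _+_ (≡.sym (∑-δ z (λ _ → 1))) (nbrsIn≡𝟙·A K z) ⟩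
    ∑[ w < n ] (δ z w * 1) + 𝟙 ∘ K · A z            ≡⟨ ≡.sym (∑-distrib-+ (λ w → δ z w * 1) (λ w → 𝟙 (K w) * A z w)) ⟩
    ∑[ w < n ] (δ z w * 1 + 𝟙 (K w) * A z w)        ≡⟨ sum-cong-≗ split ⟩
    ∑[ w < n ] 𝟙 (K w)                                 ≡⟨ ≡.sym (count≡∑𝟙 K) ⟩
    count K                                            ∎
    where
    open ≡-Reasoning
    split : ∀ w → δ z w * 1 + 𝟙 (K w) * A z w ≡ 𝟙 (K w)
    split w with z ≟ w
    ... | yes refl rewrite Kz | irrefl G z = refl
    ... | no z≢w with K w in Kw
    ...   | true  rewrite K-clique z w Kz Kw z≢w = refl
    ...   | false = refl

Layer-true : ∀ {n} (G : Graph n) K {j z} → Layer G K j z ≡ true → K z ≡ false × nbrsIn G K z ≡ j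
Layer-true G K {j} {z} z∈Xⱼ with K z | nbrsIn G K z ≡ᵇ j in e
... | false | true = refl , ≡ᵇ⇒≡ (nbrsIn G K z) j (subst T (≡.sym e) tt)

TriangleFree-⊆ : ∀ {n} {G : Graph n} {S T : Subset n} → S ⊆ T → TriangleFree G T → TriangleFree G S
TriangleFree-⊆ S⊆T T-free a b d Sa Sb Sd = T-free a b d (S⊆T a Sa) (S⊆T b Sb) (S⊆T d Sd)

module _ {n : ℕ} (G : Graph n) {r j t : ℕ}
         (A²+rA≡jJ+tI : ∀ u w → commonNeighbours G u w + r * A G u w ≡ j + t * δ u w) where

  nbrSum·nbrSum-identity : ∀ c → nbrSum G c · nbrSum G c + r * (c · nbrSum G c)
                            ≡ j * (sum c * sum c) + t * (c · c)
  nbrSum·nbrSum-identity c = begin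
    nbrSum G c · nbrSum G c + r * (c · nbrSum G c)
      ≡⟨ cong₂ (λ p q → p + r * q) (nbrSum·nbrSum≡form G c) (·nbrSum≡form G c) ⟩
    form (commonNeighbours G) c + r * form (A G) c
      ≡⟨ cong (form (commonNeighbours G) c +_) (≡.sym (form-* r (A G) c)) ⟩
    form (commonNeighbours G) c + form (λ u w → r * A G u w) c
      ≡⟨ ≡.sym (form-+ (commonNeighbours G) (λ u w → r * A G u w) c) ⟩
    form (λ u w → commonNeighbours G u w + r * A G u w) c
      ≡⟨ form-cong c A²+rA≡jJ+tI ⟩
    form (λ u w → j + t * δ u w) c
      ≡⟨ form-+ (λ _ _ → j) (λ u w → t * δ u w) c ⟩
    form (λ _ _ → j) c + form (λ u w → t * δ u w) c
      ≡⟨ cong₂ _+_ (trans (form-cong c (λ _ _ → ≡.sym (*-identityʳ j))) (form-* j (λ _ _ → 1) c)) (form-* t δ c) ⟩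
    j * form (λ _ _ → 1) c + t * form δ c
      ≡⟨ cong₂ (λ p q → j * p + t * q) (form-J c) (form-I c) ⟩
    j * (sum c * sum c) + t * (c · c)
      ∎
    where open ≡-Reasoning

eliminate-Y : ∀ B N s Y → Y + 8 * B ≡ 20 * (s * s) + 20 * N →
  100 * B + 20 * s * (40 * s) ≤ (100 * N + 40 * s * s) + (25 * Y + 95 * (4 * (s * s))) →
  5 * B ≤ 10 * N + 2 * (s * s)
eliminate-Y B N s Y Y+8B≡ le = *-cancelˡ-≤ 60 (+-cancelʳ-≤ (800 * (s * s)) _ _ (begin
  60 * (5 * B) + 800 * (s * s)                                    ≡⟨ lhs B s ⟩
  100 * B + 20 * s * (40 * s) + 200 * B                           ≤⟨ +-monoˡ-≤ (200 * B) le ⟩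
  (100 * N + 40 * s * s) + (25 * Y + 95 * (4 * (s * s))) + 200 * B ≡⟨ collect N s Y B ⟩
  100 * N + 420 * (s * s) + 25 * (Y + 8 * B)                      ≡⟨ cong (λ t → 100 * N + 420 * (s * s) + 25 * t) Y+8B≡ ⟩
  100 * N + 420 * (s * s) + 25 * (20 * (s * s) + 20 * N)          ≡⟨ rhs N s ⟩
  60 * (10 * N + 2 * (s * s)) + 800 * (s * s)                     ∎))
  where
  open ≤-Reasoning
  lhs : ∀ B s → 60 * (5 * B) + 800 * (s * s) ≡ 100 * B + 20 * s * (40 * s) + 200 * B
  lhs = solve-∀
  collect : ∀ N s Y B → (100 * N + 40 * s * s) + (25 * Y + 95 * (4 * (s * s))) + 200 * B
                        ≡ 100 * N + 420 * (s * s) + 25 * (Y + 8 * B)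
  collect = solve-∀
  rhs : ∀ N s → 100 * N + 420 * (s * s) + 25 * (20 * (s * s) + 20 * N)
                ≡ 60 * (10 * N + 2 * (s * s)) + 800 * (s * s)
  rhs = solve-∀

module _ (G : Graph 95) (srg : IsSRG 95 40 12 20 G) where

  -- A² = 40I + 12A + 20(J − I − A)
  A²+8A≡20J+20I : ∀ u w → commonNeighbours G u w + 8 * A G u w ≡ 20 + 20 * δ u w
  A²+8A≡20J+20I u w with u ≟ w
  ... | yes refl = cong₂ (λ d a → d + 8 * a) commonNeighbours-self (cong 𝟙 (irrefl G u))
    where
    commonNeighbours-self : commonNeighbours G u u ≡ 40
    commonNeighbours-self = begin
      commonNeighbours G u u  ≡⟨ commonNeighbours≡A·A G u u ⟩
      A G u · A G u           ≡⟨ sum-cong-≗ (λ z → 𝟙-idem (adj G u z)) ⟩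
      sum (A G u)             ≡⟨ ≡.sym (count≡∑𝟙 (adj G u)) ⟩
      degree G u              ≡⟨ proj₁ srg u ⟩
      40                      ∎
      where open ≡-Reasoning
  ... | no u≢w with adj G u w in uw
  ...   | true  = cong (_+ 8) (proj₁ (proj₂ srg) u w u≢w uw)
  ...   | false = cong (_+ 0) (proj₂ (proj₂ srg) u w u≢w uw)

  -- The vector 5 A c − 10 c − 2 (∑ c) 𝟏 has nonnegative squared norm; this is
  -- written as 2 p·q ≤ p·p + q·q with p = 10 c + 2 (∑ c) 𝟏 and q = 5 A c.
  quadraticForm-bound : ∀ c → 5 * (c · nbrSum G c) ≤ 10 * (c · c) + 2 * (sum c * sum c)
  quadraticForm-bound c = eliminate-Y B (c · c) s Y (nbrSum·nbrSum-identity G {8} {20} {20} A²+8A≡20J+20I c) (begin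
    100 * B + 20 * s * (40 * s)
      ≡⟨ cong (λ t → 100 * B + 20 * s * t) (≡.sym (∑nbrSum G (proj₁ srg) c)) ⟩
    100 * B + 20 * s * sum a
      ≡⟨ ≡.sym (∑-+-*ˡ 100 (20 * s) (λ z → c z * a z) a) ⟩
    ∑[ z < 95 ] (100 * (c z * a z) + 20 * s * a z)
      ≡⟨ sum-cong-≗ (λ z → ≡.sym (cross (c z) (a z) s)) ⟩
    ∑[ z < 95 ] (2 * (p z * q z))
      ≤⟨ ∑-mono-≤ (λ z → 2mn≤m²+n² (p z) (q z)) ⟩
    ∑[ z < 95 ] (p z * p z + q z * q z)
      ≡⟨ sum-cong-≗ (λ z → squares (c z) (a z) s) ⟩
    ∑[ z < 95 ] ((100 * (c z * c z) + 40 * s * c z) + (25 * (a z * a z) + 4 * (s * s)))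
      ≡⟨ ∑-distrib-+ (λ z → 100 * (c z * c z) + 40 * s * c z) (λ z → 25 * (a z * a z) + 4 * (s * s)) ⟩
    ∑[ z < 95 ] (100 * (c z * c z) + 40 * s * c z) + ∑[ z < 95 ] (25 * (a z * a z) + 4 * (s * s))
      ≡⟨ cong₂ _+_ (∑-+-*ˡ 100 (40 * s) (λ z → c z * c z) c)
                   (trans (∑-distrib-+ (λ z → 25 * (a z * a z)) (λ _ → 4 * (s * s)))
                          (cong₂ _+_ (∑-*ˡ 25 (λ z → a z * a z)) (∑-const 95 (4 * (s * s))))) ⟩
    (100 * (c · c) + 40 * s * s) + (25 * Y + 95 * (4 * (s * s)))
      ∎)
    where
    open ≤-Reasoning
    s = sum c
    a = nbrSum G c
    B = c · a
    Y = a · a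
    p q : Fin 95 → ℕ
    p z = 10 * c z + 2 * s
    q z = 5 * a z
    cross : ∀ c a s → 2 * ((10 * c + 2 * s) * (5 * a)) ≡ 100 * (c * a) + 20 * s * a
    cross = solve-∀
    squares : ∀ c a s → (10 * c + 2 * s) * (10 * c + 2 * s) + 5 * a * (5 * a)
                        ≡ (100 * (c * c) + 40 * s * c) + (25 * (a * a) + 4 * (s * s))
    squares = solve-∀

module CliqueExtension {n : ℕ} (G : Graph n) {K : Subset n} (K-clique : IsSClique 4 G K) {x y₁ y₂ y₃ : Fin n}
         (x∈X₃ : Layer G K 3 x ≡ true)
         (y₁∈X₂ : Layer G K 2 y₁ ≡ true) (y₂∈X₂ : Layer G K 2 y₂ ≡ true) (y₃∈X₂ : Layer G K 2 y₃ ≡ true)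
         (xy₁ : adj G x y₁ ≡ true) (xy₂ : adj G x y₂ ≡ true) (xy₃ : adj G x y₃ ≡ true)
         (y₁y₂ : adj G y₁ y₂ ≡ true) (y₂y₃ : adj G y₂ y₃ ≡ true) (y₁y₃ : adj G y₁ y₃ ≡ true) where

  -- The characteristic vector of K ∪ {x, y₁, y₂, y₃}: the five supports are disjoint.
  χ : Fin n → ℕ
  χ z = 𝟙 (K z) + δ x z + δ y₁ z + δ y₂ z + δ y₃ z

  private
    adj-sym : ∀ {u w} → adj G u w ≡ true → adj G w u ≡ true
    adj-sym {u} {w} uw = trans (Graph.sym G w u) uw

    δ≡0 : ∀ {u w} → adj G u w ≡ true → δ u w ≡ 0
    δ≡0 uw = δ-≢ (adj⇒≢ G uw)

    A≡1 : ∀ {u w} → adj G u w ≡ true → A G u w ≡ 1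
    A≡1 = cong 𝟙

    A-refl : ∀ u → A G u u ≡ 0
    A-refl u = cong 𝟙 (irrefl G u)

    |K| : sum (𝟙 ∘ K) ≡ 4
    |K| = trans (≡.sym (count≡∑𝟙 K)) (proj₂ K-clique)

    K∌ : ∀ {j z} → Layer G K j z ≡ true → 𝟙 (K z) ≡ 0
    K∌ z∈Xⱼ = cong 𝟙 (proj₁ (Layer-true G K z∈Xⱼ))

    nbrsIn-X : ∀ {j z} → Layer G K j z ≡ true → nbrsIn G K z ≡ j
    nbrsIn-X z∈Xⱼ = proj₂ (Layer-true G K z∈Xⱼ)

  χ·≡ : ∀ g → χ · g ≡ 𝟙 ∘ K · g + g x + g y₁ + g y₂ + g y₃
  χ·≡ g = begin
    χ · g
      ≡⟨ ·-distribʳ-+ (λ z → 𝟙 (K z) + δ x z + δ y₁ z + δ y₂ z) (δ y₃) g ⟩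
    (λ z → 𝟙 (K z) + δ x z + δ y₁ z + δ y₂ z) · g + δ y₃ · g
      ≡⟨ cong (_+ δ y₃ · g) (·-distribʳ-+ (λ z → 𝟙 (K z) + δ x z + δ y₁ z) (δ y₂) g) ⟩
    (λ z → 𝟙 (K z) + δ x z + δ y₁ z) · g + δ y₂ · g + δ y₃ · g
      ≡⟨ cong (λ t → t + δ y₂ · g + δ y₃ · g) (·-distribʳ-+ (λ z → 𝟙 (K z) + δ x z) (δ y₁) g) ⟩
    (λ z → 𝟙 (K z) + δ x z) · g + δ y₁ · g + δ y₂ · g + δ y₃ · g
      ≡⟨ cong (λ t → t + δ y₁ · g + δ y₂ · g + δ y₃ · g) (·-distribʳ-+ (𝟙 ∘ K) (δ x) g) ⟩
    𝟙 ∘ K · g + δ x · g + δ y₁ · g + δ y₂ · g + δ y₃ · g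
      ≡⟨ +-cong₅ refl (∑-δ x g) (∑-δ y₁ g) (∑-δ y₂ g) (∑-δ y₃ g) ⟩
    𝟙 ∘ K · g + g x + g y₁ + g y₂ + g y₃
      ∎
    where open ≡-Reasoning

  sum-χ : sum χ ≡ 8
  sum-χ = begin
    sum χ                                           ≡⟨ sum-cong-≗ (λ z → ≡.sym (*-identityʳ (χ z))) ⟩
    χ · (λ _ → 1)                                   ≡⟨ χ·≡ (λ _ → 1) ⟩
    𝟙 ∘ K · (λ _ → 1) + 1 + 1 + 1 + 1               ≡⟨ +-cong₅ (trans (sum-cong-≗ (λ z → *-identityʳ (𝟙 (K z)))) |K|) refl refl refl refl ⟩
    8                                               ∎
    where open ≡-Reasoning

  χ·χ : χ · χ ≡ 8
  χ·χ = trans (χ·≡ χ) (+-cong₅ 𝟙K·χ χx χy₁ χy₂ χy₃)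
    where
    𝟙K·χ : 𝟙 ∘ K · χ ≡ 4
    𝟙K·χ = trans (·-comm (𝟙 ∘ K) χ) (trans (χ·≡ (𝟙 ∘ K))
      (+-cong₅ (trans (sum-cong-≗ (𝟙-idem ∘ K)) |K|) (K∌ x∈X₃) (K∌ y₁∈X₂) (K∌ y₂∈X₂) (K∌ y₃∈X₂)))
    χx : χ x ≡ 1
    χx = +-cong₅ (K∌ x∈X₃) (δ-refl x) (δ≡0 (adj-sym xy₁)) (δ≡0 (adj-sym xy₂)) (δ≡0 (adj-sym xy₃))
    χy₁ : χ y₁ ≡ 1
    χy₁ = +-cong₅ (K∌ y₁∈X₂) (δ≡0 xy₁) (δ-refl y₁) (δ≡0 (adj-sym y₁y₂)) (δ≡0 (adj-sym y₁y₃))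
    χy₂ : χ y₂ ≡ 1
    χy₂ = +-cong₅ (K∌ y₂∈X₂) (δ≡0 xy₂) (δ≡0 y₁y₂) (δ-refl y₂) (δ≡0 (adj-sym y₂y₃))
    χy₃ : χ y₃ ≡ 1
    χy₃ = +-cong₅ (K∌ y₃∈X₂) (δ≡0 xy₃) (δ≡0 y₁y₃) (δ≡0 y₂y₃) (δ-refl y₃)

  χ·nbrSumχ : χ · nbrSum G χ ≡ 42
  χ·nbrSumχ = trans (χ·≡ (nbrSum G χ)) (+-cong₅ 𝟙K·nbrSumχ nbrSumχ-x nbrSumχ-y₁ nbrSumχ-y₂ nbrSumχ-y₃)
    where
    nbrSumχ : ∀ z → nbrSum G χ z ≡ nbrsIn G K z + A G z x + A G z y₁ + A G z y₂ + A G z y₃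
    nbrSumχ z = trans (·-comm (A G z) χ)
      (trans (χ·≡ (A G z)) (+-cong₅ (≡.sym (nbrsIn≡𝟙·A G K z)) refl refl refl refl))
    nbrSumχ-x : nbrSum G χ x ≡ 6
    nbrSumχ-x = trans (nbrSumχ x) (+-cong₅ (nbrsIn-X x∈X₃) (A-refl x) (A≡1 xy₁) (A≡1 xy₂) (A≡1 xy₃))
    nbrSumχ-y₁ : nbrSum G χ y₁ ≡ 5
    nbrSumχ-y₁ = trans (nbrSumχ y₁)
      (+-cong₅ (nbrsIn-X y₁∈X₂) (A≡1 (adj-sym xy₁)) (A-refl y₁) (A≡1 y₁y₂) (A≡1 y₁y₃))
    nbrSumχ-y₂ : nbrSum G χ y₂ ≡ 5
    nbrSumχ-y₂ = trans (nbrSumχ y₂)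
      (+-cong₅ (nbrsIn-X y₂∈X₂) (A≡1 (adj-sym xy₂)) (A≡1 (adj-sym y₁y₂)) (A-refl y₂) (A≡1 y₂y₃))
    nbrSumχ-y₃ : nbrSum G χ y₃ ≡ 5
    nbrSumχ-y₃ = trans (nbrSumχ y₃)
      (+-cong₅ (nbrsIn-X y₃∈X₂) (A≡1 (adj-sym xy₃)) (A≡1 (adj-sym y₁y₃)) (A≡1 (adj-sym y₂y₃)) (A-refl y₃))
    nbrsIn-K : ∀ z → 𝟙 (K z) * nbrSum G (𝟙 ∘ K) z ≡ 3 * 𝟙 (K z)
    nbrsIn-K z with K z in Kz
    ... | true  = trans (*-identityˡ _) (trans (nbrSum𝟙≡nbrsIn G K z)
                   (suc-injective (trans (nbrsIn-clique G (proj₁ K-clique) Kz) (proj₂ K-clique))))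
    ... | false = refl
    edges-K : 𝟙 ∘ K · nbrSum G (𝟙 ∘ K) ≡ 12
    edges-K = trans (sum-cong-≗ nbrsIn-K) (trans (∑-*ˡ 3 (𝟙 ∘ K)) (cong (3 *_) |K|))
    nbrSum𝟙K-X : ∀ {j z} → Layer G K j z ≡ true → nbrSum G (𝟙 ∘ K) z ≡ j
    nbrSum𝟙K-X {z = z} z∈Xⱼ = trans (nbrSum𝟙≡nbrsIn G K z) (nbrsIn-X z∈Xⱼ)
    𝟙K·nbrSumχ : 𝟙 ∘ K · nbrSum G χ ≡ 21
    𝟙K·nbrSumχ = trans (·nbrSum-sym G (𝟙 ∘ K) χ) (trans (χ·≡ (nbrSum G (𝟙 ∘ K)))
      (+-cong₅ edges-K (nbrSum𝟙K-X x∈X₃) (nbrSum𝟙K-X y₁∈X₂) (nbrSum𝟙K-X y₂∈X₂) (nbrSum𝟙K-X y₃∈X₂)))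

layer₂-nbhd-triangleFree : (G : Graph 95) → IsSRG 95 40 12 20 G →
  ∀ {K} → IsSClique 4 G K → ∀ {x} → Layer G K 3 x ≡ true →
  TriangleFree G (λ z → Layer G K 2 z ∧ adj G x z)
layer₂-nbhd-triangleFree G srg {K} K-clique {x} x∈X₃ a b d a∈ b∈ d∈ ab bd ad = ≤⇒≤ᵇ 210≤208
  where
  split : ∀ {z} → Layer G K 2 z ∧ adj G x z ≡ true → Layer G K 2 z ≡ true × adj G x z ≡ true
  split = ∧-true
  open CliqueExtension G K-clique x∈X₃ (proj₁ (split a∈)) (proj₁ (split b∈)) (proj₁ (split d∈))
                       (proj₂ (split a∈)) (proj₂ (split b∈)) (proj₂ (split d∈)) ab bd ad
  210≤208 : 5 * 42 ≤ 10 * 8 + 2 * (8 * 8)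
  210≤208 = subst₂ _≤_ (cong (5 *_) χ·nbrSumχ) (cong₂ (λ p q → 10 * p + 2 * (q * q)) χ·χ sum-χ)
                        (quadraticForm-bound G srg χ)

lemma18 : (G : Graph 95) → IsSRG 95 40 12 20 G →
    (K : Subset 95) → IsSClique 4 G K →
    ¬ (∃[ C ] (IsSClique 5 G C × K ⊆ C)) →
    count (Layer G K 0) ≡ 0 → count (Layer G K 1) ≡ 37 →
    count (Layer G K 2) ≡ 51 → count (Layer G K 3) ≡ 3 →
    (x : Fin 3 → Fin 95) → Injective _≡_ _≡_ x →
    (∀ z → Layer G K 3 z ≡ true → ∃[ j ] x j ≡ z) →
    (∀ j → Layer G K 3 (x j) ≡ true) →
    (i : Fin 3) → i ≢ zero →
    TriangleFree G (λ z → Layer G K 2 z ∧ adj G (x zero) z ∧ not (adj G (x i) z))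
-- Only x₀ ∈ X₃ matters: X₂ ∩ N(x₀) is already triangle-free.
lemma18 G srg K K-clique _ _ _ _ _ x _ _ x∈X₃ i _ =
  TriangleFree-⊆ {G = G} (λ z → ∧-dropʳ (Layer G K 2 z)) (layer₂-nbhd-triangleFree G srg K-clique (x∈X₃ zero))
  where
  ∧-dropʳ : ∀ a {b c} → a ∧ b ∧ c ≡ true → a ∧ b ≡ true
  ∧-dropʳ true {true} _ = refl
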